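{- Let $0<a\le b$ be integers and let $L_{a,b}=\{C_{i,1}:1\le i\le a+1\}\cup\{C_{1,j}:1<j\le b+1\}$, an $L$-shaped polyomino of size $n=a+b+1$. Then on the $n\times n$ board, $\mathrm{cp}_{\mathrm{free}}(L_{a,b})\ge 2$.
   Context: A cell $C_{i,j}$ ($i,j$ integers) is the closed unit square in column $i$ and row $j$ of the integer grid. A polyomino is a finite set of cells; its size is its number of cells. For a polyomino $\mathcal P$ of size $n$, the board is $\mathbb B=\{C_{i,j}:1\le i,j\le n\}$. A shift of $\mathcal P$ by an integer pair $(c,d)$ is $\{C_{x+c,y+d}:C_{x,y}\in\mathcal P\}$. Two polyominoes are free equivalent if one is obtained from the other by a rotation of the grid by an integer multiple of $90^\circ$ followed by a shift (reflections are not allowed). A set of polyominoes is a valid arrangement if all lie in $\mathbb B$ and they are pairwise disjoint. A free packing of $\mathcal P$ is a valid arrangement of polyominoes free equivalent to $\mathcal P$ such that adding any further polyomino free equivalent to $\mathcal P$ yields an invalid arrangement. The clumsy free packing number $\mathrm{cp}_{\mathrm{free}}(\mathcal P)$ is the minimum number of polyominoes in a free packing of $\mathcal P$ on the $n\times n$ board, $n=|\mathcal P|$. -}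

module Defs where

open import Data.Nat as ℕ using (ℕ; zero; suc)
open import Data.Integer as ℤ using (ℤ; +_; -_; _+_; _≤_)
open import Data.Product using (_×_; _,_; proj₁; proj₂; Σ; ∃; ∃-syntax)
open import Data.List using (List; []; _∷_; map; _++_; length; upTo)
open import Data.List.Membership.Propositional using (_∈_)
open import Data.List.Relation.Unary.All using (All)
open import Data.List.Relation.Unary.AllPairs using (AllPairs)
open import Data.Fin using (Fin; toℕ)
open import Data.Empty using (⊥)
open import Relation.Nullary using (¬_)
open import Function.Bundles using (_⇔_)

-- A cell C_{i,j} is represented by its integer coordinates (i , j):
-- column i, row j.
Cell : Set
Cell = ℤ × ℤ

-- A polyomino: a finite set of cells, given as a finite list
-- (only membership matters).
Polyomino : Set
Polyomino = List Cell

-- Rotation of the grid by 90° (about a lattice point); cell (i , j) ↦ (-j , i).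
-- Since rotations are always followed by an arbitrary shift, the choice of
-- rotation centre is irrelevant.
rot90 : Cell → Cell
rot90 (i , j) = (- j , i)

rotN : ℕ → Cell → Cell
rotN zero    x = x
rotN (suc k) x = rot90 (rotN k x)

shiftCell : ℤ → ℤ → Cell → Cell
shiftCell c d (i , j) = (i + c , j + d)

transform : Fin 4 → ℤ → ℤ → Polyomino → Polyomino
transform k c d P = map (λ x → shiftCell c d (rotN (toℕ k) x)) P

FreeEquiv : Polyomino → Polyomino → Set
FreeEquiv P Q = ∃[ k ] ∃[ c ] ∃[ d ] (∀ (x : Cell) → (x ∈ Q) ⇔ (x ∈ transform k c d P))

InBoard : ℕ → Polyomino → Set
InBoard n Q = ∀ (x : Cell) → x ∈ Q →
  (+ 1 ≤ proj₁ x) × (proj₁ x ≤ + n) × (+ 1 ≤ proj₂ x) × (proj₂ x ≤ + n)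

Disjoint : Polyomino → Polyomino → Set
Disjoint Q R = ∀ (x : Cell) → x ∈ Q → x ∈ R → ⊥

-- A valid arrangement on the n × n board: all in the board, pairwise disjoint.
-- (Arrangements are lists; pairwise disjointness of the list entries forces
-- the entries to be distinct, so the length is the number of polyominoes.)
ValidArrangement : ℕ → List Polyomino → Set
ValidArrangement n A = All (InBoard n) A × AllPairs Disjoint A

FreePacking : Polyomino → List Polyomino → Set
FreePacking P A =
  All (FreeEquiv P) A ×
  ValidArrangement (length P) A ×
  (∀ (Q : Polyomino) → FreeEquiv P Q → ¬ ValidArrangement (length P) (Q ∷ A))

CpFreeAtLeast : Polyomino → ℕ → Set
CpFreeAtLeast P m = ∀ (A : List Polyomino) → FreePacking P A → m ℕ.≤ length A

range : ℕ → ℕ → List ℕ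
range lo len = map (lo ℕ.+_) (upTo len)

Lshape : ℕ → ℕ → Polyomino
Lshape a b = map (λ i → (+ i , + 1)) (range 1 (suc a))
          ++ map (λ j → (+ 1 , + j)) (range 2 b)

{-# OPTIONS --safe #-}
module Submission where

-- Every placed copy of L_{a,b} fits in a (b+1) × (b+1) box and n = a+b+1 > b+1,
-- so it misses column 1 or column n, and likewise row 1 or row n.  The copy placed
-- in the corner where these meet, with its arms along the missed column and row, is
-- disjoint from it.  Hence neither the empty arrangement nor a single copy is maximal.

open import Defs
open import Data.Nat using (ℕ; _<_; _≤_)
open import Data.Nat as ℕ using (suc; z≤n; s≤s; _∸_)
import Data.Nat.Properties as ℕ
open import Data.Integer as ℤ using (ℤ; +_; 0ℤ; -[1+_]; _◃_; _⊖_; +≤+)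
import Data.Integer.Properties as ℤ
open import Data.Sign using (Sign) renaming (+ to ↑; - to ↓)
open import Data.Product using (_×_; _,_; proj₁; proj₂; ∃₂; ∃-syntax)
open import Data.Sum using (_⊎_; inj₁; inj₂)
import Data.Sum as Sum
open import Data.List using ([]; _∷_; map; length; upTo)
open import Data.List.Membership.Propositional using (_∈_)
open import Data.List.Membership.Propositional.Properties using (∈-map⁻; ∈-++⁻; ∈-upTo⁻)
open import Data.List.Properties using (length-++; length-map; length-upTo)
open import Data.List.Relation.Unary.All using ([]; _∷_)
open import Data.List.Relation.Unary.AllPairs using ([]; _∷_)
open import Data.Fin using (Fin; toℕ)
open import Data.Fin.Patterns using (0F; 1F; 2F; 3F)
open import Data.Empty using (⊥-elim)
open import Relation.Nullary using (yes; no)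
open import Relation.Binary.PropositionalEquality using (_≡_; _≢_; refl; sym; trans; cong₂; subst; module ≡-Reasoning)
open import Function.Base using (id)
open import Function.Bundles using (mk⇔; Equivalence)

record Hook (m u v : ℕ) : Set where
  constructor hook
  field
    1≤u : 1 ≤ u
    u≤m : u ≤ m
    1≤v : 1 ≤ v
    v≤m : v ≤ m
    at-corner : u ≡ 1 ⊎ v ≡ 1

Hook-swap : ∀ {m u v} → Hook m u v → Hook m v u
Hook-swap (hook 1≤u u≤m 1≤v v≤m at-corner) = hook 1≤v v≤m 1≤u u≤m (Sum.swap at-corner)

HookCell : ℕ → Cell → Set
HookCell m x = ∃₂ λ u v → Hook m u v × x ≡ (+ u , + v)

HookShaped : ℕ → Polyomino → Set
HookShaped m P = ∀ x → x ∈ P → HookCell m x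

∈-range⁻ : ∀ lo len {v} → v ∈ range lo len → ∃[ k ] (k < len × v ≡ lo ℕ.+ k)
∈-range⁻ lo len v∈ with ∈-map⁻ (lo ℕ.+_) v∈
... | k , k∈ , refl = k , ∈-upTo⁻ k∈ , refl

length-range : ∀ lo len → length (range lo len) ≡ len
length-range lo len = trans (length-map (lo ℕ.+_) (upTo len)) (length-upTo len)

length-Lshape : ∀ a b → length (Lshape a b) ≡ suc a ℕ.+ b
length-Lshape a b = begin
  length (Lshape a b)
    ≡⟨ length-++ (map (λ i → (+ i , + 1)) (range 1 (suc a))) ⟩
  length (map (λ i → (+ i , + 1)) (range 1 (suc a))) ℕ.+ length (map (λ j → (+ 1 , + j)) (range 2 b))
    ≡⟨ cong₂ ℕ._+_ (length-map _ (range 1 (suc a))) (length-map _ (range 2 b)) ⟩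
  length (range 1 (suc a)) ℕ.+ length (range 2 b)
    ≡⟨ cong₂ ℕ._+_ (length-range 1 (suc a)) (length-range 2 b) ⟩
  suc a ℕ.+ b ∎
  where open ≡-Reasoning

Lshape-hookShaped : ∀ {a b m} → a ≤ m → b ≤ m → HookShaped (suc m) (Lshape a b)
Lshape-hookShaped {a} {b} a≤m b≤m x x∈ with ∈-++⁻ (map (λ i → (+ i , + 1)) (range 1 (suc a))) x∈
... | inj₁ x∈row with ∈-map⁻ (λ i → (+ i , + 1)) x∈row
...   | i , i∈ , refl with ∈-range⁻ 1 (suc a) i∈
...     | k , k<1+a , refl =
  suc k , 1 , hook (s≤s z≤n) (ℕ.≤-trans k<1+a (s≤s a≤m)) (s≤s z≤n) (s≤s z≤n) (inj₂ refl) , refl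
Lshape-hookShaped {a} {b} a≤m b≤m x x∈ | inj₂ x∈column with ∈-map⁻ (λ j → (+ 1 , + j)) x∈column
...   | j , j∈ , refl with ∈-range⁻ 2 b j∈
...     | k , k<b , refl =
  1 , suc (suc k) , hook (s≤s z≤n) (s≤s z≤n) (s≤s z≤n) (s≤s (ℕ.≤-trans k<b b≤m)) (inj₁ refl) , refl

-- The rotation sending a cell (u , v) to (s ◃ u , t ◃ v) or to (s ◃ v , t ◃ u).
rotation : Sign → Sign → Fin 4
rotation ↑ ↑ = 0F
rotation ↓ ↑ = 1F
rotation ↓ ↓ = 2F
rotation ↑ ↓ = 3F

rotation-surjective : ∀ k → ∃₂ λ s t → rotation s t ≡ k
rotation-surjective 0F = ↑ , ↑ , refl
rotation-surjective 1F = ↓ , ↑ , refl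
rotation-surjective 2F = ↓ , ↓ , refl
rotation-surjective 3F = ↑ , ↓ , refl

∈-transform⁻ : ∀ {m P x} s t c d → HookShaped m P →
  x ∈ transform (rotation s t) c d P →
  ∃₂ λ u v → Hook m u v × x ≡ ((s ◃ u) ℤ.+ c , (t ◃ v) ℤ.+ d)
∈-transform⁻ {m} s t c d hooked x∈ with ∈-map⁻ _ x∈
... | y , y∈P , refl with hooked y y∈P
... | u , v , h , refl = rotated s t h
  where
  rotated : ∀ s t {u v} → Hook m u v →
    ∃₂ λ u′ v′ → Hook m u′ v′ ×
      shiftCell c d (rotN (toℕ (rotation s t)) (+ u , + v)) ≡ ((s ◃ u′) ℤ.+ c , (t ◃ v′) ℤ.+ d)
  rotated ↑ ↑ h@(hook (s≤s z≤n) _ (s≤s z≤n) _ _) = _ , _ , h , refl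
  rotated ↓ ↑ h@(hook (s≤s z≤n) _ (s≤s z≤n) _ _) = _ , _ , Hook-swap h , refl
  rotated ↓ ↓ h@(hook (s≤s z≤n) _ (s≤s z≤n) _ _) = _ , _ , h , refl
  rotated ↑ ↓ h@(hook (s≤s z≤n) _ (s≤s z≤n) _ _) = _ , _ , Hook-swap h , refl

endpoint : ℕ → Sign → ℤ
endpoint n ↑ = + 1
endpoint n ↓ = + n

short-segment-misses-endpoint : ∀ {m n} → m < n → ∀ s c →
  ∃[ e ] ∀ {u} → 1 ≤ u → u ≤ m → (s ◃ u) ℤ.+ c ≢ endpoint n e
short-segment-misses-endpoint {m} {n} m<n ↑ c with c ℤ.≤? 0ℤ
... | yes c≤0 = ↓ , λ { {suc u} _ u≤m eq → ℕ.<⇒≱ (ℕ.≤-<-trans u≤m m<n) (ℤ.drop‿+≤+ (begin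
        + n             ≡⟨ sym eq ⟩
        + suc u ℤ.+ c   ≤⟨ ℤ.+-monoʳ-≤ (+ suc u) c≤0 ⟩
        + suc u ℤ.+ 0ℤ  ≡⟨ ℤ.+-identityʳ (+ suc u) ⟩
        + suc u         ∎)) }
  where open ℤ.≤-Reasoning
... | no c≰0 = ↑ , λ { {suc u} _ _ eq → ℤ.<-irrefl refl (begin-strict
        + 1             ≤⟨ +≤+ (s≤s z≤n) ⟩
        + suc u         ≡⟨ ℤ.+-identityʳ (+ suc u) ⟨
        + suc u ℤ.+ 0ℤ  <⟨ ℤ.+-monoʳ-< (+ suc u) (ℤ.≰⇒> c≰0) ⟩
        + suc u ℤ.+ c   ≡⟨ eq ⟩
        + 1             ∎) }
  where open ℤ.≤-Reasoning
short-segment-misses-endpoint {m} {n} m<n ↓ c with c ℤ.≤? + n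
... | yes c≤n = ↓ , λ { {suc u} _ _ eq → ℤ.<-irrefl refl (begin-strict
        + n              ≡⟨ eq ⟨
        -[1+ u ] ℤ.+ c   ≤⟨ ℤ.+-monoʳ-≤ -[1+ u ] c≤n ⟩
        n ⊖ suc u        <⟨ ℤ.m⊖1+n<m n (suc u) ⟩
        + n              ∎) }
  where open ℤ.≤-Reasoning
... | no c≰n = ↑ , λ { {suc u} _ u≤m eq → ℤ.<-irrefl refl (begin-strict
        + 1              ≤⟨ +≤+ (ℕ.m<n⇒0<n∸m (ℕ.≤-<-trans u≤m m<n)) ⟩
        + (n ∸ suc u)    ≡⟨ ℤ.⊖-≥ (ℕ.<⇒≤ (ℕ.≤-<-trans u≤m m<n)) ⟨
        n ⊖ suc u        <⟨ ℤ.+-monoʳ-< -[1+ u ] (ℤ.≰⇒> c≰n) ⟩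
        -[1+ u ] ℤ.+ c   ≡⟨ eq ⟩
        + 1              ∎) }
  where open ℤ.≤-Reasoning

-- As u runs over 1 … n, (s ◃ u) + anchor n s runs over the board from endpoint n s.
anchor : ℕ → Sign → ℤ
anchor n ↑ = 0ℤ
anchor n ↓ = + suc n

anchored-at-1 : ∀ n s → (s ◃ 1) ℤ.+ anchor n s ≡ endpoint n s
anchored-at-1 n ↑ = refl
anchored-at-1 n ↓ = refl

anchored-inBoard : ∀ {n u} s → 1 ≤ u → u ≤ n →
  + 1 ℤ.≤ (s ◃ u) ℤ.+ anchor n s × (s ◃ u) ℤ.+ anchor n s ℤ.≤ + n
anchored-inBoard ↑ (s≤s z≤n) u≤n = +≤+ (s≤s z≤n) , +≤+ (ℕ.≤-trans (ℕ.≤-reflexive (ℕ.+-identityʳ _)) u≤n)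
anchored-inBoard {n} {suc u} ↓ (s≤s z≤n) u<n
  rewrite ℤ.⊖-≥ {suc n} {suc u} (ℕ.m≤n⇒m≤1+n u<n) =
  +≤+ (ℕ.m<n⇒0<n∸m u<n) , +≤+ (ℕ.m∸n≤m n u)

cornerCopy : ℕ → Sign → Sign → Polyomino → Polyomino
cornerCopy n s t = transform (rotation s t) (anchor n s) (anchor n t)

cornerCopy-freeEquiv : ∀ n s t P → FreeEquiv P (cornerCopy n s t P)
cornerCopy-freeEquiv n s t P = rotation s t , anchor n s , anchor n t , λ _ → mk⇔ id id

cornerCopy-inBoard : ∀ {m n P} s t → HookShaped m P → m ≤ n → InBoard n (cornerCopy n s t P)
cornerCopy-inBoard s t hooked m≤n x x∈ with ∈-transform⁻ s t _ _ hooked x∈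
... | _ , _ , hook 1≤u u≤m 1≤v v≤m _ , refl =
  let 1≤x₁ , x₁≤n = anchored-inBoard s 1≤u (ℕ.≤-trans u≤m m≤n)
      1≤x₂ , x₂≤n = anchored-inBoard t 1≤v (ℕ.≤-trans v≤m m≤n)
  in 1≤x₁ , x₁≤n , 1≤x₂ , x₂≤n

cornerCopy-onEdges : ∀ {m n P} s t → HookShaped m P → ∀ x → x ∈ cornerCopy n s t P →
  proj₁ x ≡ endpoint n s ⊎ proj₂ x ≡ endpoint n t
cornerCopy-onEdges {n = n} s t hooked x x∈ with ∈-transform⁻ s t _ _ hooked x∈
... | _ , _ , hook _ _ _ _ (inj₁ refl) , refl = inj₁ (anchored-at-1 n s)
... | _ , _ , hook _ _ _ _ (inj₂ refl) , refl = inj₂ (anchored-at-1 n t)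

module _ {a b : ℕ} (0<a : 0 < a) (a≤b : a ≤ b) where
  private
    L = Lshape a b
    n = length L

    L-hookShaped : HookShaped (suc b) L
    L-hookShaped = Lshape-hookShaped a≤b ℕ.≤-refl

    1+b<n : suc b < n
    1+b<n = subst (suc b <_) (sym (length-Lshape a b)) (s≤s (ℕ.m<n+m b 0<a))

    L-cornerCopy-inBoard : ∀ s t → InBoard n (cornerCopy n s t L)
    L-cornerCopy-inBoard s t = cornerCopy-inBoard s t L-hookShaped (ℕ.<⇒≤ 1+b<n)

  Lshape-copy : ∃[ Q ] (FreeEquiv L Q × InBoard n Q)
  Lshape-copy = cornerCopy n ↑ ↑ L , cornerCopy-freeEquiv n ↑ ↑ L , L-cornerCopy-inBoard ↑ ↑

  Lshape-disjointCopy : ∀ Q → FreeEquiv L Q → ∃[ Q′ ] (FreeEquiv L Q′ × InBoard n Q′ × Disjoint Q′ Q)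
  Lshape-disjointCopy Q (k , c , d , Q≈) with rotation-surjective k
  ... | s , t , refl with short-segment-misses-endpoint 1+b<n s c | short-segment-misses-endpoint 1+b<n t d
  ... | e , misses-e | f , misses-f =
    cornerCopy n e f L , cornerCopy-freeEquiv n e f L , L-cornerCopy-inBoard e f , disjoint
    where
    disjoint : Disjoint (cornerCopy n e f L) Q
    disjoint x x∈Q′ x∈Q
      with ∈-transform⁻ s t c d L-hookShaped (Equivalence.to (Q≈ x) x∈Q) | cornerCopy-onEdges e f L-hookShaped x x∈Q′
    ... | _ , _ , hook 1≤u u≤m _ _ _ , refl | inj₁ x₁≡e = misses-e 1≤u u≤m x₁≡e
    ... | _ , _ , hook _ _ 1≤v v≤m _ , refl | inj₂ x₂≡f = misses-f 1≤v v≤m x₂≡f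

lemma3p9 : (a b : ℕ) → 0 < a → a ≤ b → CpFreeAtLeast (Lshape a b) 2
lemma3p9 a b 0<a a≤b [] (_ , _ , maximal) with Lshape-copy 0<a a≤b
... | Q , Q≈L , Q-inBoard = ⊥-elim (maximal Q Q≈L (Q-inBoard ∷ [] , [] ∷ []))
lemma3p9 a b 0<a a≤b (Q ∷ []) (Q≈L ∷ [] , (Q-inBoard ∷ [] , _) , maximal)
  with Lshape-disjointCopy 0<a a≤b Q Q≈L
... | Q′ , Q′≈L , Q′-inBoard , Q′∩Q=∅ =
  ⊥-elim (maximal Q′ Q′≈L (Q′-inBoard ∷ Q-inBoard ∷ [] , (Q′∩Q=∅ ∷ []) ∷ [] ∷ []))
lemma3p9 a b _ _ (_ ∷ _ ∷ _) _ = s≤s (s≤s z≤n)
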